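{- Let $\mathbf f$ be a $k$-ary function symbol of $\mathcal M$, $k\in\{0,1,2\}$, with $\mathbf f\notin\{\times,\div,\mathbf p\}$. Then there exists an existential first-order formula $\psi(x_0,\dots,x_{k-1},y,z)$ of $\mathcal M$ such that for all $d,t\in\omega$ with $d\ge t$ and all $a_0,\dots,a_{k-1},b\in\mathbf M_d$, we have $\mathbf f_{d,t}(a_0,\dots,a_{k-1})=b$ if and only if $\mathbf M_d\models\psi(a_0,\dots,a_{k-1},b,t)$.
   Context: $\mathcal M$ is the first-order language with equality with constant symbols $\mathbf 0,\mathbf 1,-\mathbf 1,\mathbf n$, unary function symbols $\mathcal N,\mathbf p$, and binary function symbols $+,\times,\div,\max,\min,\cap$. For $d\in\omega$ and $n=2^d$, $\mathbf M_d$ has universe $\{0,\dots,2^n-1\}$; $+,\times$ are modulo $2^n$; $\mathbf p(x)=\min\{2^x,2^n-1\}$; $\div(x,y)=\lfloor x/y\rfloor$ for $y\neq0$ and $0$ for $y=0$; constants $\mathbf 0,\mathbf 1,\mathbf n,-\mathbf 1$ denote $0,1,n,2^n-1$; $\max,\min$ usual; $\cap$ bitwise AND and $\mathcal N$ bitwise complement on $n$-bit binary representations. For $a,t\in\omega$ and an integer $i$, $a[i,t]$ denotes the $i$-th digit of $a$ in base $2^{2^t}$ (so $a=\sum_i a[i,t]2^{i2^t}$; $a[i,t]=0$ for $i<0$). For $d\ge t$ and a $k$-ary function symbol $\mathbf f$, the function $\mathbf f_{d,t}$ on $\mathbf M_d$ is defined by: $\mathbf f_{d,t}(a_0,\dots,a_{k-1})$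 is the unique $b\in\mathbf M_d$ such that for all $i<2^{d-t}$, $\mathbf M_t\models\mathbf f(a_0[i,t],\dots,a_{k-1}[i,t])=b[i,t]$ (i.e., $\mathbf f$ is applied componentwise to the vectors of base-$2^{2^t}$ digits). -}

module Defs where

open import Data.Nat using (ℕ; zero; suc; _+_; _*_; _∸_; _^_; _≤_; _<_; _⊓_; _⊔_; NonZero)
open import Data.Nat.Properties using (m^n≢0)
open import Data.Nat.DivMod using (_/_; _%_)
open import Data.Fin using (Fin)
open import Data.Vec using (Vec; []; _∷_; lookup)
open import Data.Product using (Σ; _×_; _,_)
open import Data.Sum using (_⊎_)
open import Data.Empty using (⊥)
open import Relation.Binary.PropositionalEquality using (_≡_)
open import Relation.Nullary using (¬_)

modPow2 : ℕ → ℕ → ℕ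
modPow2 a m = _%_ a (2 ^ m) {{m^n≢0 2 m}}

divPow2 : ℕ → ℕ → ℕ
divPow2 a m = _/_ a (2 ^ m) {{m^n≢0 2 m}}

divZ : ℕ → ℕ → ℕ
divZ x zero    = 0
divZ x (suc y) = x / suc y

bitAnd : ℕ → ℕ → ℕ → ℕ
bitAnd zero    a b = 0
bitAnd (suc m) a b = (a % 2) * (b % 2) + 2 * bitAnd m (a / 2) (b / 2)

bitNot : ℕ → ℕ → ℕ
bitNot zero    a = 0
bitNot (suc m) a = (1 ∸ (a % 2)) + 2 * bitNot m (a / 2)

-- The structure M_d : universe {0,…,2^n - 1} with n = 2^d

nOf : ℕ → ℕ
nOf d = 2 ^ d

size : ℕ → ℕ
size d = 2 ^ nOf d

data Sym : ℕ → Set where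
  𝟎 𝟏 -𝟏 𝐧       : Sym 0
  𝓝 𝐩            : Sym 1
  plus times divs mx mn cap : Sym 2

interp : ∀ {k} → ℕ → Sym k → Vec ℕ k → ℕ
interp d 𝟎    []          = 0
interp d 𝟏    []          = 1
interp d -𝟏   []          = size d ∸ 1
interp d 𝐧    []          = nOf d
interp d 𝓝    (x ∷ [])     = bitNot (nOf d) x
interp d 𝐩    (x ∷ [])     = (2 ^ x) ⊓ (size d ∸ 1)
interp d plus  (x ∷ y ∷ []) = modPow2 (x + y) (nOf d)
interp d times (x ∷ y ∷ []) = modPow2 (x * y) (nOf d)
interp d divs  (x ∷ y ∷ []) = divZ x y
interp d mx    (x ∷ y ∷ []) = x ⊔ y
interp d mn    (x ∷ y ∷ []) = x ⊓ y
interp d cap   (x ∷ y ∷ []) = bitAnd (nOf d) x y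

data Term (n : ℕ) : Set where
  var : Fin n → Term n
  app : ∀ {k} → Sym k → Vec (Term n) k → Term n

data QF (n : ℕ) : Set where
  _≐_  : Term n → Term n → QF n
  ⊥'   : QF n
  ¬'_  : QF n → QF n
  _∧'_ : QF n → QF n → QF n
  _∨'_ : QF n → QF n → QF n
  _⇒'_ : QF n → QF n → QF n

data ExFormula (n : ℕ) : Set where
  qf : QF n → ExFormula n
  ∃' : ExFormula (suc n) → ExFormula n

-- Semantics in M_d ; environments are vectors of elements of M_d
-- (bound variable 0 is the innermost one)

mutual
  evalT : ∀ {n} → ℕ → Vec ℕ n → Term n → ℕ
  evalT d ρ (var i)    = lookup ρ i
  evalT d ρ (app f ts) = interp d f (evalTs d ρ ts)

  evalTs : ∀ {n k} → ℕ → Vec ℕ n → Vec (Term n) k → Vec ℕ k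
  evalTs d ρ []       = []
  evalTs d ρ (t ∷ ts) = evalT d ρ t ∷ evalTs d ρ ts

SatQF : ∀ {n} → ℕ → Vec ℕ n → QF n → Set
SatQF d ρ (s ≐ t)  = evalT d ρ s ≡ evalT d ρ t
SatQF d ρ ⊥'       = ⊥
SatQF d ρ (¬' φ)   = ¬ SatQF d ρ φ
SatQF d ρ (φ ∧' ψ) = SatQF d ρ φ × SatQF d ρ ψ
SatQF d ρ (φ ∨' ψ) = SatQF d ρ φ ⊎ SatQF d ρ ψ
SatQF d ρ (φ ⇒' ψ) = SatQF d ρ φ → SatQF d ρ ψ

Sat : ∀ {n} → ℕ → Vec ℕ n → ExFormula n → Set
Sat d ρ (qf θ) = SatQF d ρ θ
Sat d ρ (∃' φ) = Σ ℕ λ x → x < size d × Sat d (x ∷ ρ) φ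

digit : ℕ → ℕ → ℕ → ℕ
digit a i t = modPow2 (divPow2 a (i * 2 ^ t)) (2 ^ t)

CompValue : ∀ {k} → ℕ → ℕ → Sym k → Vec ℕ k → ℕ → Set
CompValue d t f as b =
  b < size d ×
  (∀ i → i < 2 ^ (d ∸ t) →
     interp t f (Data.Vec.map (λ a → digit a i t) as) ≡ digit b i t)

data Forbidden : ∀ {k} → Sym k → Set where
  isTimes : Forbidden times
  isDiv   : Forbidden divs
  isP     : Forbidden 𝐩

-- Split an element of M_d into N = 2^(d ∸ t) digits of width w = 2^t. Every symbol other than
-- ×, ÷ and 𝐩 acts digitwise by a term T(x, t) of 𝓜, so ψ can be taken to be the equation y = T(x, z).
-- From t the terms compute w = 𝐩 t, h = 2^(w ∸ 1), W ∸ 1 = 2h ∸ 1 for W = 2^w, the number with all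
-- digits 1 as (−1) ÷ (W ∸ 1), and from it a mask of the top bits of all digits. Bitwise ∧ and ¬ act digitwise
-- as they are; + does so once no carry crosses a digit boundary, which is arranged by adding only the
-- low parts and restoring the top bits by xor. Comparing the top bits, and the low parts by a
-- borrow-free subtraction, gives a mask selecting the larger (or smaller) digit for max and min.

module Submission where

open import Data.Nat
open import Data.Nat.Properties
open import Data.Nat.DivMod
open import Data.Nat.Divisibility using (divides-refl)
open import Data.Nat.Tactic.RingSolver using (solve-∀)
open import Data.Fin using (#_)
open import Data.Vec using (Vec; []; _∷_; _++_)
open import Data.Vec.Relation.Unary.All using (All; []; _∷_)
open import Data.Product using (Σ; _×_; _,_; proj₁; proj₂)
open import Data.Sum using (_⊎_; inj₁; inj₂)
open import Data.Empty using (⊥-elim)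
open import Function.Bundles using (_⇔_; mk⇔)
open import Relation.Binary.PropositionalEquality
open import Relation.Nullary using (¬_; yes; no)
open import Defs

open ≤-Reasoning

[r+q*D]%D≡r : ∀ r q D .{{_ : NonZero D}} → r < D → (r + q * D) % D ≡ r
[r+q*D]%D≡r r q D r<D = trans ([m+kn]%n≡m%n r q D) (m<n⇒m%n≡m r<D)

[r+q*D]/D≡q : ∀ r q D .{{_ : NonZero D}} → r < D → (r + q * D) / D ≡ q
[r+q*D]/D≡q r q D r<D =
  trans (+-distrib-/-∣ʳ r (divides-refl q)) (cong₂ _+_ (m<n⇒m/n≡0 r<D) (m*n/n≡m q D))

+-∸-+ : ∀ {x y u v} → u ≤ x → v ≤ y → (x + y) ∸ (u + v) ≡ (x ∸ u) + (y ∸ v)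
+-∸-+ {x} {y} {u} {v} u≤x v≤y = begin-equality
  (x + y) ∸ (u + v)                          ≡⟨ cong₂ (λ X Y → (X + Y) ∸ (u + v)) (m+[n∸m]≡n u≤x) (m+[n∸m]≡n v≤y) ⟨
  ((u + (x ∸ u)) + (v + (y ∸ v))) ∸ (u + v)  ≡⟨ cong (_∸ (u + v)) (regroup u (x ∸ u) v (y ∸ v)) ⟩
  ((x ∸ u) + (y ∸ v) + (u + v)) ∸ (u + v)    ≡⟨ m+n∸n≡m _ (u + v) ⟩
  (x ∸ u) + (y ∸ v)                          ∎
  where regroup : ∀ u p v q → (u + p) + (v + q) ≡ p + q + (u + v)
        regroup = solve-∀

2^≢0 : ∀ m → NonZero (2 ^ m)
2^≢0 m = m^n≢0 2 m

private
  bit≤1 : ∀ x → x % 2 ≤ 1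
  bit≤1 x = ≤-pred (m%n<n x 2)

  bit+2*q≡ : ∀ r q → r ≤ 1 → (r + 2 * q) % 2 ≡ r × (r + 2 * q) / 2 ≡ q
  bit+2*q≡ r q r≤1 rewrite *-comm 2 q = [r+q*D]%D≡r r q 2 (s≤s r≤1) , [r+q*D]/D≡q r q 2 (s≤s r≤1)

  x+a*2p≡ : ∀ x a p → x + a * (2 * p) ≡ x % 2 + (x / 2 + a * p) * 2
  x+a*2p≡ x a p = begin-equality
    x + a * (2 * p)                   ≡⟨ cong (_+ a * (2 * p)) (m≡m%n+[m/n]*n x 2) ⟩
    x % 2 + x / 2 * 2 + a * (2 * p)   ≡⟨ shuffle (x % 2) (x / 2) a p ⟩
    x % 2 + (x / 2 + a * p) * 2       ∎
    where shuffle : ∀ r q a p → r + q * 2 + a * (2 * p) ≡ r + (q + a * p) * 2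
          shuffle = solve-∀

  [x+a*2p]%2≡x%2 : ∀ x a p → (x + a * (2 * p)) % 2 ≡ x % 2
  [x+a*2p]%2≡x%2 x a p = trans (cong (_% 2) (x+a*2p≡ x a p)) ([r+q*D]%D≡r (x % 2) (x / 2 + a * p) 2 (m%n<n x 2))

  [x+a*2p]/2≡x/2+a*p : ∀ x a p → (x + a * (2 * p)) / 2 ≡ x / 2 + a * p
  [x+a*2p]/2≡x/2+a*p x a p = trans (cong (_/ 2) (x+a*2p≡ x a p)) ([r+q*D]/D≡q (x % 2) (x / 2 + a * p) 2 (m%n<n x 2))

  x<2^1+w⇒x/2<2^w : ∀ {x} w → x < 2 ^ suc w → x / 2 < 2 ^ w
  x<2^1+w⇒x/2<2^w {x} w x< = m<n*o⇒m/o<n (subst (x <_) (*-comm 2 (2 ^ w)) x<)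

  r+2[k+c*p]≡ : ∀ r k c p → r + 2 * (k + c * p) ≡ (r + 2 * k) + c * (2 * p)
  r+2[k+c*p]≡ = solve-∀

bitAnd-split : ∀ w m x y a b → x < 2 ^ w → y < 2 ^ w →
  bitAnd (w + m) (x + a * 2 ^ w) (y + b * 2 ^ w) ≡ bitAnd w x y + bitAnd m a b * 2 ^ w
bitAnd-split zero m zero zero a b (s≤s z≤n) (s≤s z≤n)
  rewrite *-identityʳ a | *-identityʳ b | *-identityʳ (bitAnd m a b) = refl
bitAnd-split (suc w) m x y a b x< y< = begin-equality
  (X % 2) * (Y % 2) + 2 * bitAnd (w + m) (X / 2) (Y / 2)
    ≡⟨ cong₂ (λ u v → u + 2 * v)
         (cong₂ _*_ ([x+a*2p]%2≡x%2 x a (2 ^ w)) ([x+a*2p]%2≡x%2 y b (2 ^ w)))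
         (cong₂ (bitAnd (w + m)) ([x+a*2p]/2≡x/2+a*p x a (2 ^ w)) ([x+a*2p]/2≡x/2+a*p y b (2 ^ w))) ⟩
  (x % 2) * (y % 2) + 2 * bitAnd (w + m) (x / 2 + a * 2 ^ w) (y / 2 + b * 2 ^ w)
    ≡⟨ cong (λ u → (x % 2) * (y % 2) + 2 * u)
         (bitAnd-split w m (x / 2) (y / 2) a b (x<2^1+w⇒x/2<2^w w x<) (x<2^1+w⇒x/2<2^w w y<)) ⟩
  (x % 2) * (y % 2) + 2 * (bitAnd w (x / 2) (y / 2) + bitAnd m a b * 2 ^ w)
    ≡⟨ r+2[k+c*p]≡ ((x % 2) * (y % 2)) (bitAnd w (x / 2) (y / 2)) (bitAnd m a b) (2 ^ w) ⟩
  bitAnd (suc w) x y + bitAnd m a b * 2 ^ suc w ∎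
  where X = x + a * 2 ^ suc w
        Y = y + b * 2 ^ suc w

bitNot-split : ∀ w m x a → x < 2 ^ w →
  bitNot (w + m) (x + a * 2 ^ w) ≡ bitNot w x + bitNot m a * 2 ^ w
bitNot-split zero m zero a (s≤s z≤n)
  rewrite *-identityʳ a | *-identityʳ (bitNot m a) = refl
bitNot-split (suc w) m x a x< = begin-equality
  (1 ∸ X % 2) + 2 * bitNot (w + m) (X / 2)
    ≡⟨ cong₂ (λ u v → (1 ∸ u) + 2 * v)
         ([x+a*2p]%2≡x%2 x a (2 ^ w)) (cong (bitNot (w + m)) ([x+a*2p]/2≡x/2+a*p x a (2 ^ w))) ⟩
  (1 ∸ x % 2) + 2 * bitNot (w + m) (x / 2 + a * 2 ^ w)
    ≡⟨ cong (λ u → (1 ∸ x % 2) + 2 * u) (bitNot-split w m (x / 2) a (x<2^1+w⇒x/2<2^w w x<)) ⟩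
  (1 ∸ x % 2) + 2 * (bitNot w (x / 2) + bitNot m a * 2 ^ w)
    ≡⟨ r+2[k+c*p]≡ (1 ∸ x % 2) (bitNot w (x / 2)) (bitNot m a) (2 ^ w) ⟩
  bitNot (suc w) x + bitNot m a * 2 ^ suc w ∎
  where X = x + a * 2 ^ suc w

private
  bit+2*k<2*B : ∀ r k B → r ≤ 1 → k < B → r + 2 * k < 2 * B
  bit+2*k<2*B r k B r≤1 k<B = begin-strict
    r + 2 * k     <⟨ s≤s (+-monoˡ-≤ (2 * k) r≤1) ⟩
    2 + 2 * k     ≡⟨ *-distribˡ-+ 2 1 k ⟨
    2 * suc k     ≤⟨ *-monoʳ-≤ 2 k<B ⟩
    2 * B         ∎

bitAnd<2^ : ∀ m a b → bitAnd m a b < 2 ^ m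
bitAnd<2^ zero a b = s≤s z≤n
bitAnd<2^ (suc m) a b = bit+2*k<2*B _ _ _ (*-mono-≤ (bit≤1 a) (bit≤1 b)) (bitAnd<2^ m (a / 2) (b / 2))

bitNot<2^ : ∀ m a → bitNot m a < 2 ^ m
bitNot<2^ zero a = s≤s z≤n
bitNot<2^ (suc m) a = bit+2*k<2*B _ _ _ (m∸n≤m 1 (a % 2)) (bitNot<2^ m (a / 2))

bitAnd-zeroˡ : ∀ m b → bitAnd m 0 b ≡ 0
bitAnd-zeroˡ zero b = refl
bitAnd-zeroˡ (suc m) b = cong (2 *_) (bitAnd-zeroˡ m (b / 2))

bitAnd-zeroʳ : ∀ m a → bitAnd m a 0 ≡ 0
bitAnd-zeroʳ zero a = refl
bitAnd-zeroʳ (suc m) a rewrite *-zeroʳ (a % 2) = cong (2 *_) (bitAnd-zeroʳ m (a / 2))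

allOnes : ℕ → ℕ
allOnes m = bitNot m 0

bitAnd-allOnesʳ : ∀ m x → x < 2 ^ m → bitAnd m x (allOnes m) ≡ x
bitAnd-allOnesʳ zero zero _ = refl
bitAnd-allOnesʳ zero (suc x) (s≤s ())
bitAnd-allOnesʳ (suc m) x x< = begin-equality
  (x % 2) * (1s % 2) + 2 * bitAnd m (x / 2) (1s / 2)
    ≡⟨ cong₂ (λ u v → (x % 2) * u + 2 * bitAnd m (x / 2) v) (proj₁ 1s≡) (proj₂ 1s≡) ⟩
  (x % 2) * 1 + 2 * bitAnd m (x / 2) (allOnes m)
    ≡⟨ cong₂ (λ u v → u + 2 * v) (*-identityʳ (x % 2)) (bitAnd-allOnesʳ m (x / 2) (x<2^1+w⇒x/2<2^w m x<)) ⟩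
  x % 2 + 2 * (x / 2)
    ≡⟨ cong (x % 2 +_) (*-comm 2 (x / 2)) ⟩
  x % 2 + (x / 2) * 2
    ≡⟨ m≡m%n+[m/n]*n x 2 ⟨
  x ∎
  where 1s = 1 + 2 * allOnes m
        1s≡ = bit+2*q≡ 1 (allOnes m) (s≤s z≤n)

bitNot+id+1≡2^ : ∀ m b → b < 2 ^ m → bitNot m b + b + 1 ≡ 2 ^ m
bitNot+id+1≡2^ zero zero _ = refl
bitNot+id+1≡2^ zero (suc b) (s≤s ())
bitNot+id+1≡2^ (suc m) b b< = begin-equality
  (1 ∸ b % 2) + 2 * bitNot m (b / 2) + b + 1
    ≡⟨ cong (λ v → (1 ∸ b % 2) + 2 * bitNot m (b / 2) + v + 1) (m≡m%n+[m/n]*n b 2) ⟩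
  (1 ∸ b % 2) + 2 * bitNot m (b / 2) + (b % 2 + (b / 2) * 2) + 1
    ≡⟨ regroup (1 ∸ b % 2) (b % 2) (bitNot m (b / 2)) (b / 2) ⟩
  ((1 ∸ b % 2) + b % 2) + 2 * (bitNot m (b / 2) + b / 2) + 1
    ≡⟨ cong (λ u → u + 2 * (bitNot m (b / 2) + b / 2) + 1) (m∸n+n≡m (bit≤1 b)) ⟩
  1 + 2 * (bitNot m (b / 2) + b / 2) + 1
    ≡⟨ double (bitNot m (b / 2)) (b / 2) ⟩
  2 * (bitNot m (b / 2) + b / 2 + 1)
    ≡⟨ cong (2 *_) (bitNot+id+1≡2^ m (b / 2) (x<2^1+w⇒x/2<2^w m b<)) ⟩
  2 ^ suc m ∎
  where regroup : ∀ u r k q → u + 2 * k + (r + q * 2) + 1 ≡ (u + r) + 2 * (k + q) + 1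
        regroup = solve-∀
        double : ∀ k q → 1 + 2 * (k + q) + 1 ≡ 2 * (k + q + 1)
        double = solve-∀

-- Digit sequences in base B

module Base (B : ℕ) {{B≢0 : NonZero B}} where

  data Digits : ℕ → ℕ → (ℕ → ℕ) → Set where
    done : ∀ {f} → Digits 0 0 f
    next : ∀ {N a f} → a % B ≡ f 0 → Digits N (a / B) (λ i → f (suc i)) → Digits (suc N) a f

  head<B : ∀ {N a f} → Digits (suc N) a f → f 0 < B
  head<B {a = a} (next a%B≡ _) = subst (_< B) a%B≡ (m%n<n a B)

  digit<B : ∀ {N a f} → Digits N a f → ∀ i → i < N → f i < B
  digit<B ds@(next _ _) zero _ = head<B ds
  digit<B (next _ ds) (suc i) (s≤s i<N) = digit<B ds i i<N

  ≡head+tail*B : ∀ {N a f} → Digits (suc N) a f → a ≡ f 0 + (a / B) * B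
  ≡head+tail*B {a = a} (next a%B≡ _) = trans (m≡m%n+[m/n]*n a B) (cong (_+ (a / B) * B) a%B≡)

  digits-∷ : ∀ {N a a′ f} → a ≡ f 0 + a′ * B → f 0 < B → Digits N a′ (λ i → f (suc i)) →
             Digits (suc N) a f
  digits-∷ {N} {a′ = a′} {f} refl f0<B ds =
    next ([r+q*D]%D≡r (f 0) a′ B f0<B) (subst (λ v → Digits N v _) (sym ([r+q*D]/D≡q (f 0) a′ B f0<B)) ds)

  value<B^N : ∀ {N a f} → Digits N a f → a < B ^ N
  value<B^N done = s≤s z≤n
  value<B^N {suc N} {a} {f} ds@(next _ ds′) = begin-strict
    a                   ≡⟨ ≡head+tail*B ds ⟩
    f 0 + (a / B) * B   <⟨ +-monoˡ-< _ (head<B ds) ⟩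
    suc (a / B) * B     ≤⟨ *-monoˡ-≤ B (value<B^N ds′) ⟩
    B ^ N * B           ≡⟨ *-comm (B ^ N) B ⟩
    B ^ suc N           ∎

  digits-cong : ∀ {N a f g} → (∀ i → i < N → f i ≡ g i) → Digits N a f → Digits N a g
  digits-cong f≗g done = done
  digits-cong f≗g (next a%B≡ ds) =
    next (trans a%B≡ (f≗g 0 (s≤s z≤n))) (digits-cong (λ i i<N → f≗g (suc i) (s≤s i<N)) ds)

  digits-injective : ∀ {N a b f} → Digits N a f → Digits N b f → a ≡ b
  digits-injective done done = refl
  digits-injective da@(next _ da′) db@(next _ db′) =
    trans (≡head+tail*B da) (trans (cong (λ u → _ + u * B) (digits-injective da′ db′)) (sym (≡head+tail*B db)))

  digitOf : ℕ → ℕ → ℕ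
  digitOf a i = a / B ^ i % B
    where instance _ = m^n≢0 B i

  digitOf-/B : ∀ a i → digitOf (a / B) i ≡ digitOf a (suc i)
  digitOf-/B a i = cong (_% B) (m/n/o≡m/[n*o] a B (B ^ i) {{_}} {{m^n≢0 B i}} {{m^n≢0 B (suc i)}})

  digits-digitOf : ∀ N a → a < B ^ N → Digits N a (digitOf a)
  digits-digitOf zero zero _ = done
  digits-digitOf zero (suc a) (s≤s ())
  digits-digitOf (suc N) a a< = next (cong (_% B) (sym (n/1≡n a)))
    (digits-cong (λ i _ → digitOf-/B a i)
      (digits-digitOf N (a / B) (m<n*o⇒m/o<n (subst (a <_) (*-comm B (B ^ N)) a<))))

  digitOf-digits : ∀ {N a f} → Digits N a f → ∀ i → i < N → digitOf a i ≡ f i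
  digitOf-digits {a = a} (next a%B≡ _) zero _ = trans (cong (_% B) (n/1≡n a)) a%B≡
  digitOf-digits {a = a} (next _ ds) (suc i) (s≤s i<N) = trans (sym (digitOf-/B a i)) (digitOf-digits ds i i<N)

  digits-+ : ∀ {N a b f g} → (∀ i → i < N → f i + g i < B) →
             Digits N a f → Digits N b g → Digits N (a + b) (λ i → f i + g i)
  digits-+ _ done done = done
  digits-+ {a = a} {b} {f} {g} f+g<B da@(next _ da′) db@(next _ db′) =
    digits-∷ (trans (cong₂ _+_ (≡head+tail*B da) (≡head+tail*B db)) (regroup (f 0) (a / B) (g 0) (b / B) B))
      (f+g<B 0 (s≤s z≤n)) (digits-+ (λ i i<N → f+g<B (suc i) (s≤s i<N)) da′ db′)
    where regroup : ∀ x a y b B → (x + a * B) + (y + b * B) ≡ (x + y) + (a + b) * B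
          regroup = solve-∀

  digits-∸ : ∀ {N a b f g} → (∀ i → i < N → g i ≤ f i) →
             Digits N a f → Digits N b g → b ≤ a × Digits N (a ∸ b) (λ i → f i ∸ g i)
  digits-∸ _ done done = z≤n , done
  digits-∸ {a = a} {b} {f} {g} g≤f da@(next _ da′) db@(next _ db′) =
    subst₂ _≤_ (sym (≡head+tail*B db)) (sym (≡head+tail*B da)) (+-mono-≤ g0≤f0 b/B*B≤a/B*B) ,
    digits-∷ a∸b≡ (≤-<-trans (m∸n≤m (f 0) (g 0)) (head<B da)) ds′
    where
    g0≤f0 = g≤f 0 (s≤s z≤n)
    rest = digits-∸ (λ i i<N → g≤f (suc i) (s≤s i<N)) da′ db′
    ds′ = proj₂ rest
    b/B*B≤a/B*B = *-monoˡ-≤ B (proj₁ rest)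
    a∸b≡ : a ∸ b ≡ (f 0 ∸ g 0) + (a / B ∸ b / B) * B
    a∸b≡ = begin-equality
      a ∸ b                                         ≡⟨ cong₂ _∸_ (≡head+tail*B da) (≡head+tail*B db) ⟩
      (f 0 + a / B * B) ∸ (g 0 + b / B * B)         ≡⟨ +-∸-+ g0≤f0 b/B*B≤a/B*B ⟩
      (f 0 ∸ g 0) + (a / B * B ∸ b / B * B)         ≡⟨ cong (f 0 ∸ g 0 +_) (*-distribʳ-∸ B (a / B) (b / B)) ⟨
      (f 0 ∸ g 0) + (a / B ∸ b / B) * B             ∎

  digits-*ʳ : ∀ {N a f} c → (∀ i → i < N → f i * c < B) → Digits N a f → Digits N (a * c) (λ i → f i * c)
  digits-*ʳ c _ done = done
  digits-*ʳ {a = a} {f} c fc<B da@(next _ da′) =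
    digits-∷ (trans (cong (_* c) (≡head+tail*B da)) (distrib (f 0) (a / B) c B))
      (fc<B 0 (s≤s z≤n)) (digits-*ʳ c (λ i i<N → fc<B (suc i) (s≤s i<N)) da′)
    where distrib : ∀ x a c B → (x + a * B) * c ≡ x * c + (a * c) * B
          distrib = solve-∀

  digits-/ʳ : ∀ {N a f} c → (∀ i → i < N → f i < B) → Digits N a (λ i → f i * c) →
              Σ ℕ λ v → a ≡ v * c × Digits N v f
  digits-/ʳ c _ done = 0 , refl , done
  digits-/ʳ {a = a} {f} c f<B da@(next _ da′) with digits-/ʳ c (λ i i<N → f<B (suc i) (s≤s i<N)) da′
  ... | v , a/B≡v*c , dv =
    f 0 + v * B ,
    trans (≡head+tail*B da) (trans (cong (λ u → f 0 * c + u * B) a/B≡v*c) (distrib (f 0) v c B)) ,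
    digits-∷ refl (f<B 0 (s≤s z≤n)) dv
    where distrib : ∀ x v c B → x * c + (v * c) * B ≡ (x + v * B) * c
          distrib = solve-∀

  digits-zero : ∀ N → Digits N 0 (λ _ → 0)
  digits-zero zero = done
  digits-zero (suc N) = digits-∷ refl (>-nonZero⁻¹ B) (digits-zero N)

  repunit : ℕ → ℕ
  repunit zero = 0
  repunit (suc N) = 1 + repunit N * B

  digits-repunit : 1 < B → ∀ N → Digits N (repunit N) (λ _ → 1)
  digits-repunit 1<B zero = done
  digits-repunit 1<B (suc N) = digits-∷ refl 1<B (digits-repunit 1<B N)

  repunit*[B∸1]+1≡B^ : ∀ N → repunit N * (B ∸ 1) + 1 ≡ B ^ N
  repunit*[B∸1]+1≡B^ zero = refl
  repunit*[B∸1]+1≡B^ (suc N) = begin-equality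
    (1 + R * B) * (B ∸ 1) + 1      ≡⟨ regroup R B (B ∸ 1) ⟩
    (B ∸ 1 + 1) + R * (B ∸ 1) * B  ≡⟨ cong (_+ R * (B ∸ 1) * B) (m∸n+n≡m (>-nonZero⁻¹ B)) ⟩
    B + R * (B ∸ 1) * B            ≡⟨ factor B (R * (B ∸ 1)) ⟩
    B * (R * (B ∸ 1) + 1)          ≡⟨ cong (B *_) (repunit*[B∸1]+1≡B^ N) ⟩
    B ^ suc N                      ∎
    where R = repunit N
          regroup : ∀ e B m → (1 + e * B) * m + 1 ≡ (m + 1) + e * m * B
          regroup = solve-∀
          factor : ∀ B k → B + k * B ≡ B * (k + 1)
          factor = solve-∀

module BinaryBase (w : ℕ) where
  open Base (2 ^ w) {{2^≢0 w}} public

  digits-bitAnd : ∀ {N a b f g} → Digits N a f → Digits N b g →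
                  Digits N (bitAnd (N * w) a b) (λ i → bitAnd w (f i) (g i))
  digits-bitAnd done done = done
  digits-bitAnd {suc N} da@(next _ da′) db@(next _ db′) =
    digits-∷ (trans (cong₂ (bitAnd (w + N * w)) (≡head+tail*B da) (≡head+tail*B db))
                    (bitAnd-split w (N * w) _ _ _ _ (head<B da) (head<B db)))
      (bitAnd<2^ w _ _) (digits-bitAnd da′ db′)

  digits-bitNot : ∀ {N a f} → Digits N a f → Digits N (bitNot (N * w) a) (λ i → bitNot w (f i))
  digits-bitNot done = done
  digits-bitNot {suc N} da@(next _ da′) =
    digits-∷ (trans (cong (bitNot (w + N * w)) (≡head+tail*B da))
                    (bitNot-split w (N * w) _ _ (head<B da)))
      (bitNot<2^ w _) (digits-bitNot da′)

-- A single digit of width 1 + w′: its top bit and its low part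

andNot : ℕ → ℕ → ℕ
andNot a zero = a
andNot a (suc _) = 0

xor : ℕ → ℕ → ℕ
xor a b = andNot a b + andNot b a

xor≤1 : ∀ {a b} → a ≤ 1 → b ≤ 1 → xor a b ≤ 1
xor≤1 z≤n z≤n = z≤n
xor≤1 z≤n (s≤s z≤n) = s≤s z≤n
xor≤1 (s≤s z≤n) z≤n = s≤s z≤n
xor≤1 (s≤s z≤n) (s≤s z≤n) = z≤n

xor-xor≡sum%2 : ∀ {a b c} → a ≤ 1 → b ≤ 1 → c ≤ 1 → xor (xor a b) c ≡ (c + a + b) % 2
xor-xor≡sum%2 z≤n z≤n z≤n = refl
xor-xor≡sum%2 z≤n z≤n (s≤s z≤n) = refl
xor-xor≡sum%2 z≤n (s≤s z≤n) z≤n = refl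
xor-xor≡sum%2 z≤n (s≤s z≤n) (s≤s z≤n) = refl
xor-xor≡sum%2 (s≤s z≤n) z≤n z≤n = refl
xor-xor≡sum%2 (s≤s z≤n) z≤n (s≤s z≤n) = refl
xor-xor≡sum%2 (s≤s z≤n) (s≤s z≤n) z≤n = refl
xor-xor≡sum%2 (s≤s z≤n) (s≤s z≤n) (s≤s z≤n) = refl

module Digit (w′ : ℕ) where
  w = suc w′
  h = 2 ^ w′
  W = 2 ^ w

  instance
    h≢0 : NonZero h
    h≢0 = 2^≢0 w′
    W≢0 : NonZero W
    W≢0 = 2^≢0 w

  W≡h+h : W ≡ h + h
  W≡h+h = cong (h +_) (+-identityʳ h)

  0<h : 0 < h
  0<h = m^n>0 2 w′

  1<W : 1 < W
  1<W = *-monoʳ-≤ 2 0<h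

  h<W : h < W
  h<W = subst (h <_) (sym W≡h+h) (m<m+n h 0<h)

  lo+lo<W : ∀ x y → x % h + y % h < W
  lo+lo<W x y = subst (x % h + y % h <_) (sym W≡h+h) (+-mono-< (m%n<n x h) (m%n<n y h))

  lo+bit*h<W : ∀ a p → a < h → p ≤ 1 → a + p * h < W
  lo+bit*h<W a p a<h p≤1 = begin-strict
    a + p * h  <⟨ +-monoˡ-< _ a<h ⟩
    h + p * h  ≤⟨ +-monoʳ-≤ h (subst (p * h ≤_) (+-identityʳ h) (*-monoˡ-≤ h p≤1)) ⟩
    h + h      ≡⟨ W≡h+h ⟨
    W          ∎

  top≤1 : ∀ x → x < W → x / h ≤ 1
  top≤1 x x<W = ≤-pred (m<n*o⇒m/o<n {x} {2} {h} x<W)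

  bitAnd-top : ∀ x → x < W → bitAnd w x h ≡ (x / h) * h
  bitAnd-top x x<W = begin-equality
    bitAnd w x h
      ≡⟨ cong₂ (bitAnd w) (m≡m%n+[m/n]*n x h) (sym (*-identityˡ h)) ⟩
    bitAnd w (x % h + (x / h) * h) (0 + 1 * h)
      ≡⟨ cong (λ k → bitAnd k (x % h + (x / h) * h) (0 + 1 * h)) (+-comm w′ 1) ⟨
    bitAnd (w′ + 1) (x % h + (x / h) * h) (0 + 1 * h)
      ≡⟨ bitAnd-split w′ 1 (x % h) 0 (x / h) 1 (m%n<n x h) 0<h ⟩
    bitAnd w′ (x % h) 0 + bitAnd 1 (x / h) 1 * h
      ≡⟨ cong₂ (λ u v → u + v * h) (bitAnd-zeroʳ w′ (x % h))
           (trans (+-identityʳ _) (trans (*-identityʳ _) (m<n⇒m%n≡m (s≤s (top≤1 x x<W))))) ⟩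
    (x / h) * h ∎

  bitAnd-bitNot≡andNot : ∀ a b → a ≤ 1 → b ≤ 1 → bitAnd w a (bitNot w b) ≡ andNot a b
  bitAnd-bitNot≡andNot a b a≤1 b≤1 = begin-equality
    (a % 2) * (C % 2) + 2 * bitAnd w′ (a / 2) (C / 2)
      ≡⟨ cong₂ (λ u v → u * (C % 2) + 2 * bitAnd w′ v (C / 2)) (m<n⇒m%n≡m (s≤s a≤1)) (m<n⇒m/n≡0 (s≤s a≤1)) ⟩
    a * (C % 2) + 2 * bitAnd w′ 0 (C / 2)
      ≡⟨ cong (λ v → a * (C % 2) + 2 * v) (bitAnd-zeroˡ w′ (C / 2)) ⟩
    a * (C % 2) + 0
      ≡⟨ +-identityʳ _ ⟩
    a * (C % 2)
      ≡⟨ cong (a *_) C%2≡ ⟩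
    a * (1 ∸ b % 2)
      ≡⟨ cong (λ v → a * (1 ∸ v)) (m<n⇒m%n≡m (s≤s b≤1)) ⟩
    a * (1 ∸ b)
      ≡⟨ a*[1∸b]≡andNot b b≤1 ⟩
    andNot a b ∎
    where
    C = bitNot w b
    C%2≡ : C % 2 ≡ 1 ∸ b % 2
    C%2≡ rewrite *-comm 2 (bitNot w′ (b / 2)) = [r+q*D]%D≡r (1 ∸ b % 2) (bitNot w′ (b / 2)) 2 (s≤s (m∸n≤m 1 (b % 2)))
    a*[1∸b]≡andNot : ∀ b → b ≤ 1 → a * (1 ∸ b) ≡ andNot a b
    a*[1∸b]≡andNot zero _ = *-identityʳ a
    a*[1∸b]≡andNot (suc zero) _ = *-zeroʳ a
    a*[1∸b]≡andNot (suc (suc _)) (s≤s ())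

  -- The low parts are added without overflow; their carry and the two top bits then give the
  -- top bit of the sum by parity, and the carry out of the digit is lost.
  +-digit : ∀ x y → x < W → y < W →
    (x % h + y % h) % h + xor (xor (x / h) (y / h)) ((x % h + y % h) / h) * h ≡ (x + y) % W
  +-digit x y x<W y<W = begin-equality
    u % h + xor (xor (x / h) (y / h)) (u / h) * h
      ≡⟨ cong (λ v → u % h + v * h) (xor-xor≡sum%2 (top≤1 x x<W) (top≤1 y y<W) (top≤1 u (lo+lo<W x y))) ⟩
    u % h + (s % 2) * h
      ≡⟨ [r+q*D]%D≡r (u % h + (s % 2) * h) (s / 2) W (lo+bit*h<W _ _ (m%n<n u h) (≤-pred (m%n<n s 2))) ⟨
    (u % h + (s % 2) * h + (s / 2) * W) % W
      ≡⟨ cong (_% W) u%h+s*h≡x+y ⟩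
    (x + y) % W ∎
    where
    u = x % h + y % h
    s = u / h + x / h + y / h
    u%h+s*h≡x+y : u % h + (s % 2) * h + (s / 2) * W ≡ x + y
    u%h+s*h≡x+y = begin-equality
      u % h + (s % 2) * h + (s / 2) * W
        ≡⟨ shift (u % h) (s % 2) (s / 2) h ⟩
      u % h + (s % 2 + (s / 2) * 2) * h
        ≡⟨ cong (λ v → u % h + v * h) (m≡m%n+[m/n]*n s 2) ⟨
      u % h + s * h
        ≡⟨ distrib (u % h) (u / h) (x / h) (y / h) h ⟩
      (u % h + (u / h) * h) + (x / h) * h + (y / h) * h
        ≡⟨ cong (λ v → v + (x / h) * h + (y / h) * h) (m≡m%n+[m/n]*n u h) ⟨
      (x % h + y % h) + (x / h) * h + (y / h) * h
        ≡⟨ regroup (x % h) (y % h) (x / h) (y / h) h ⟩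
      (x % h + (x / h) * h) + (y % h + (y / h) * h)
        ≡⟨ cong₂ _+_ (m≡m%n+[m/n]*n x h) (m≡m%n+[m/n]*n y h) ⟨
      x + y ∎
      where shift : ∀ ul r q h → ul + r * h + q * (2 * h) ≡ ul + (r + q * 2) * h
            shift = solve-∀
            distrib : ∀ ul ub xb yb h → ul + (ub + xb + yb) * h ≡ (ul + ub * h) + xb * h + yb * h
            distrib = solve-∀
            regroup : ∀ xl yl xb yb h → (xl + yl) + xb * h + yb * h ≡ (xl + xb * h) + (yl + yb * h)
            regroup = solve-∀

  top<top⇒< : ∀ {x y} → x / h < y / h → x < y
  top<top⇒< {x} {y} x/h<y/h = begin-strict
    x                    ≡⟨ m≡m%n+[m/n]*n x h ⟩
    x % h + (x / h) * h  <⟨ +-monoˡ-< _ (m%n<n x h) ⟩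
    suc (x / h) * h      ≤⟨ *-monoˡ-≤ h x/h<y/h ⟩
    (y / h) * h          ≤⟨ m/n*n≤m y h ⟩
    y                    ∎

  lowGeq : ℕ → ℕ → ℕ
  lowGeq x y = ((x % h + h) ∸ y % h) / h

  lowGeq-spec : ∀ x y → (lowGeq x y ≡ 1 × y % h ≤ x % h) ⊎ (lowGeq x y ≡ 0 × x % h < y % h)
  lowGeq-spec x y with y % h ≤? x % h
  ... | yes y≤x = inj₁ (trans (cong (_/ h) (trans (+-∸-comm h y≤x) (cong (x % h ∸ y % h +_) (sym (*-identityˡ h)))))
                          ([r+q*D]/D≡q _ 1 h (≤-<-trans (m∸n≤m (x % h) (y % h)) (m%n<n x h))) , y≤x)
  ... | no y≰x = inj₂ (m<n⇒m/n≡0 (m<n+o⇒m∸n<o (x % h + h) (y % h) (+-monoˡ-< h x<y)) , x<y)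
    where x<y = ≰⇒> y≰x

  geqFrom : ℕ → ℕ → ℕ → ℕ
  geqFrom xTop yTop lowBit = andNot xTop yTop + andNot lowBit (xor xTop yTop)

  geq : ℕ → ℕ → ℕ
  geq x y = geqFrom (x / h) (y / h) (lowGeq x y)

  private
    sameTop-spec : ∀ x y → x / h ≡ y / h → (lowGeq x y ≡ 1 × y ≤ x) ⊎ (lowGeq x y ≡ 0 × x < y)
    sameTop-spec x y top≡ with lowGeq-spec x y
    ... | inj₁ (eq , y≤x) = inj₁ (eq , subst₂ _≤_ (sym (m≡m%n+[m/n]*n y h)) (sym (m≡m%n+[m/n]*n x h))
                                         (+-mono-≤ y≤x (≤-reflexive (cong (_* h) (sym top≡)))))
    ... | inj₂ (eq , x<y) = inj₂ (eq , subst₂ _<_ (sym (m≡m%n+[m/n]*n x h)) (sym (m≡m%n+[m/n]*n y h))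
                                         (+-mono-<-≤ x<y (≤-reflexive (cong (_* h) top≡))))

    top-bit : ∀ x → x < W → x / h ≡ 0 ⊎ x / h ≡ 1
    top-bit x x<W with x / h | top≤1 x x<W
    ... | 0 | _ = inj₁ refl
    ... | 1 | _ = inj₂ refl
    ... | suc (suc _) | s≤s ()

  geq-spec : ∀ x y → x < W → y < W →
             (geqFrom (x / h) (y / h) (lowGeq x y) ≡ 1 × y ≤ x) ⊎ (geqFrom (x / h) (y / h) (lowGeq x y) ≡ 0 × x < y)
  geq-spec x y x<W y<W with top-bit x x<W | top-bit y y<W
  ... | inj₁ x0 | inj₁ y0 rewrite x0 | y0 = sameTop-spec x y (trans x0 (sym y0))
  ... | inj₂ x1 | inj₂ y1 rewrite x1 | y1 = sameTop-spec x y (trans x1 (sym y1))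
  ... | inj₂ x1 | inj₁ y0 rewrite x1 | y0 = inj₁ (refl , <⇒≤ (top<top⇒< (subst₂ _<_ (sym y0) (sym x1) (s≤s z≤n))))
  ... | inj₁ x0 | inj₂ y1 rewrite x0 | y1 = inj₂ (refl , top<top⇒< (subst₂ _<_ (sym x0) (sym y1) (s≤s z≤n)))

  geq≤1 : ∀ x y → x < W → y < W → geq x y ≤ 1
  geq≤1 x y x<W y<W with geq-spec x y x<W y<W
  ... | inj₁ (eq , _) = ≤-reflexive eq
  ... | inj₂ (eq , _) = subst (_≤ 1) (sym eq) z≤n

  m : ℕ
  m = W ∸ 1

  m+1≡W : m + 1 ≡ W
  m+1≡W = m∸n+n≡m (<-trans (s≤s z≤n) 1<W)

  0<m : 0 < m
  0<m = m<n⇒0<n∸m 1<W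

  m<W : m < W
  m<W = subst (m <_) m+1≡W (m<m+n m (s≤s z≤n))

  allOnes≡m : allOnes w ≡ m
  allOnes≡m = begin-equality
    allOnes w            ≡⟨ m+n∸n≡m (allOnes w) 1 ⟨
    allOnes w + 1 ∸ 1    ≡⟨ cong (λ u → u + 1 ∸ 1) (+-identityʳ (allOnes w)) ⟨
    allOnes w + 0 + 1 ∸ 1 ≡⟨ cong (_∸ 1) (bitNot+id+1≡2^ w 0 (m^n>0 2 w)) ⟩
    m                    ∎

  bitNot-m≡0 : bitNot w m ≡ 0
  bitNot-m≡0 = +-cancelʳ-≡ (m + 1) (bitNot w m) 0
    (trans (sym (+-assoc (bitNot w m) m 1)) (trans (bitNot+id+1≡2^ w m m<W) (sym m+1≡W)))

  select : ℕ → ℕ → ℕ → ℕ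
  select g a b = bitAnd w a (g * m) + bitAnd w b (bitNot w (g * m))

  select-1 : ∀ a b → a < W → select 1 a b ≡ a
  select-1 a b a<W
    rewrite *-identityˡ m | bitNot-m≡0 | bitAnd-zeroʳ w b | sym allOnes≡m | bitAnd-allOnesʳ w a a<W = +-identityʳ a

  select-0 : ∀ a b → b < W → select 0 a b ≡ b
  select-0 a b b<W rewrite bitAnd-zeroʳ w a = bitAnd-allOnesʳ w b b<W

  max-digit : ∀ x y → x < W → y < W → select (geq x y) x y ≡ x ⊔ y
  max-digit x y x<W y<W with geq-spec x y x<W y<W
  ... | inj₁ (eq , y≤x) rewrite eq = trans (select-1 x y x<W) (sym (m≥n⇒m⊔n≡m y≤x))
  ... | inj₂ (eq , x<y) rewrite eq = trans (select-0 x y y<W) (sym (m≤n⇒m⊔n≡n (<⇒≤ x<y)))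

  min-digit : ∀ x y → x < W → y < W → select (geq x y) y x ≡ x ⊓ y
  min-digit x y x<W y<W with geq-spec x y x<W y<W
  ... | inj₁ (eq , y≤x) rewrite eq = trans (select-1 y x y<W) (sym (m≥n⇒m⊓n≡n y≤x))
  ... | inj₂ (eq , x<y) rewrite eq = trans (select-0 y x x<W) (sym (m≤n⇒m⊓n≡m (<⇒≤ x<y)))

module Word (d w′ N : ℕ) (n≡N*w : nOf d ≡ N * suc w′) where
  open Digit w′ public
  open BinaryBase w public

  n = nOf d
  M = size d

  instance
    M≢0 : NonZero M
    M≢0 = 2^≢0 n

  M≡W^N : M ≡ W ^ N
  M≡W^N = trans (cong (2 ^_) (trans n≡N*w (*-comm N w))) (sym (^-*-assoc 2 w N))

  0<N : 0 < N
  0<N = positive N n≡N*w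
    where positive : ∀ N → nOf d ≡ N * w → 0 < N
          positive zero n≡0 = ⊥-elim (<⇒≢ (m^n>0 2 d) (sym n≡0))
          positive (suc _) _ = s≤s z≤n

  W≤M : W ≤ M
  W≤M = subst (W ≤_) (sym M≡W^N) (subst (_≤ W ^ N) (*-identityʳ W) (^-monoʳ-≤ W {{W≢0}} 0<N))

  digits<M : ∀ {a f} → Digits N a f → a < M
  digits<M ds = subst (_ <_) (sym M≡W^N) (value<B^N ds)

  digits-%M : ∀ {a f} → Digits N a f → a % M ≡ a
  digits-%M ds = m<n⇒m%n≡m (digits<M ds)

  digits-cap : ∀ {a b f g} → Digits N a f → Digits N b g →
               Digits N (interp d cap (a ∷ b ∷ [])) (λ i → bitAnd w (f i) (g i))
  digits-cap {a} {b} da db = subst (λ k → Digits N (bitAnd k a b) _) (sym n≡N*w) (digits-bitAnd da db)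

  digits-𝓝 : ∀ {a f} → Digits N a f → Digits N (interp d 𝓝 (a ∷ [])) (λ i → bitNot w (f i))
  digits-𝓝 {a} da = subst (λ k → Digits N (bitNot k a) _) (sym n≡N*w) (digits-bitNot da)

  digits-plus : ∀ {a b f g} → (∀ i → i < N → f i + g i < W) → Digits N a f → Digits N b g →
                Digits N (interp d plus (a ∷ b ∷ [])) (λ i → f i + g i)
  digits-plus f+g<W da db =
    let ds = digits-+ f+g<W da db in subst (λ v → Digits N v _) (sym (digits-%M ds)) ds

  digits-times : ∀ {a f} c → (∀ i → i < N → f i * c < W) → Digits N a f →
                 Digits N (interp d times (a ∷ c ∷ [])) (λ i → f i * c)
  digits-times c fc<W da =
    let ds = digits-*ʳ c fc<W da in subst (λ v → Digits N v _) (sym (digits-%M ds)) ds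

  digits-divs : ∀ {a f} c → 0 < c → (∀ i → i < N → f i < W) → Digits N a (λ i → f i * c) →
                Digits N (interp d divs (a ∷ c ∷ [])) f
  digits-divs {a} (suc c) _ f<W da with digits-/ʳ (suc c) f<W da
  ... | v , refl , dv = subst (λ u → Digits N u _) (sym (m*n/n≡m v (suc c))) dv

  -- a + ¬b + 1 = (a ∸ b) + 2^n, so this is the true difference whenever b ≤ a.
  minus : ℕ → ℕ → ℕ
  minus a b = interp d plus (interp d plus (a ∷ interp d 𝓝 (b ∷ []) ∷ []) ∷ interp d 𝟏 [] ∷ [])

  minus≡∸ : ∀ a b → b ≤ a → a < M → minus a b ≡ a ∸ b
  minus≡∸ a b b≤a a<M = begin-equality
    ((a + ¬b) % M + 1) % M  ≡⟨ %-distribˡ-+ ((a + ¬b) % M) 1 M ⟩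
    ((a + ¬b) % M % M + 1 % M) % M  ≡⟨ cong (λ u → (u + 1 % M) % M) (m%n%n≡m%n (a + ¬b) M) ⟩
    ((a + ¬b) % M + 1 % M) % M  ≡⟨ %-distribˡ-+ (a + ¬b) 1 M ⟨
    (a + ¬b + 1) % M  ≡⟨ cong (λ u → (u + ¬b + 1) % M) (m∸n+n≡m b≤a) ⟨
    ((a ∸ b) + b + ¬b + 1) % M  ≡⟨ cong (_% M) (regroup (a ∸ b) b ¬b) ⟩
    ((a ∸ b) + (¬b + b + 1)) % M  ≡⟨ cong (λ u → ((a ∸ b) + u) % M) (bitNot+id+1≡2^ n b (≤-<-trans b≤a a<M)) ⟩
    ((a ∸ b) + M) % M  ≡⟨ [m+n]%n≡m%n (a ∸ b) M ⟩
    (a ∸ b) % M  ≡⟨ m<n⇒m%n≡m (≤-<-trans (m∸n≤m a b) a<M) ⟩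
    a ∸ b ∎
    where ¬b = bitNot n b
          regroup : ∀ x b c → x + b + c + 1 ≡ x + (c + b + 1)
          regroup = solve-∀

  digits-minus : ∀ {a b f g} → (∀ i → i < N → g i ≤ f i) → Digits N a f → Digits N b g →
                 Digits N (minus a b) (λ i → f i ∸ g i)
  digits-minus {a} {b} g≤f da db with digits-∸ g≤f da db
  ... | b≤a , ds = subst (λ v → Digits N v _) (sym (minus≡∸ a b b≤a (digits<M da))) ds

  plus-[-1] : ∀ v → 0 < v → v < M → interp d plus (v ∷ interp d -𝟏 [] ∷ []) ≡ v ∸ 1
  plus-[-1] (suc v) _ v<M = begin-equality
    (suc v + (M ∸ 1)) % M  ≡⟨ cong (_% M) (+-suc v (M ∸ 1)) ⟨
    (v + suc (M ∸ 1)) % M  ≡⟨ cong (λ u → (v + u) % M) (suc-pred M) ⟩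
    (v + M) % M            ≡⟨ [m+n]%n≡m%n v M ⟩
    v % M                  ≡⟨ m<n⇒m%n≡m (<-trans (n<1+n v) v<M) ⟩
    v ∎

  𝐩≡2^ : ∀ v → 2 ^ v < M → interp d 𝐩 (v ∷ []) ≡ 2 ^ v
  𝐩≡2^ v 2^v<M = m≤n⇒m⊓n≡m (suc[m]≤n⇒m≤pred[n] 2^v<M)

  M∸1≡repunit*m : M ∸ 1 ≡ repunit N * m
  M∸1≡repunit*m = begin-equality
    M ∸ 1                       ≡⟨ cong (_∸ 1) (trans M≡W^N (sym (repunit*[B∸1]+1≡B^ N))) ⟩
    repunit N * m + 1 ∸ 1       ≡⟨ m+n∸n≡m (repunit N * m) 1 ⟩
    repunit N * m               ∎

  digits-[-1] : Digits N (M ∸ 1) (λ _ → m)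
  digits-[-1] = subst (λ v → Digits N v (λ _ → m)) (sym M∸1≡repunit*m)
    (digits-cong (λ _ _ → *-identityˡ m) (digits-*ʳ m (λ _ _ → subst (_< W) (sym (*-identityˡ m)) m<W) (digits-repunit 1<W N)))

-- Terms for the digitwise operations, built from a term z denoting t

infixl 6 _+ᵗ_ _−ᵗ_
infixl 7 _∧ᵗ_ _×ᵗ_ _÷ᵗ_

_+ᵗ_ _∧ᵗ_ _×ᵗ_ _÷ᵗ_ _−ᵗ_ : ∀ {k} → Term k → Term k → Term k
a +ᵗ b = app plus (a ∷ b ∷ [])
a ∧ᵗ b = app cap (a ∷ b ∷ [])
a ×ᵗ b = app times (a ∷ b ∷ [])
a ÷ᵗ b = app divs (a ∷ b ∷ [])
a −ᵗ b = (a +ᵗ app 𝓝 (b ∷ [])) +ᵗ app 𝟏 []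

¬ᵗ_ 𝐩ᵗ : ∀ {k} → Term k → Term k
¬ᵗ a = app 𝓝 (a ∷ [])
𝐩ᵗ a = app 𝐩 (a ∷ [])

-𝟏ᵗ : ∀ {k} → Term k
-𝟏ᵗ = app -𝟏 []

module Gadgets {k : ℕ} (z : Term k) where
  widthᵗ halfᵗ maskᵗ onesᵗ widthsᵗ topMaskᵗ : Term k
  widthᵗ = 𝐩ᵗ z
  halfᵗ = 𝐩ᵗ (widthᵗ +ᵗ -𝟏ᵗ)
  maskᵗ = halfᵗ +ᵗ (halfᵗ +ᵗ -𝟏ᵗ)
  onesᵗ = -𝟏ᵗ ÷ᵗ maskᵗ
  widthsᵗ = onesᵗ ×ᵗ widthᵗ
  topMaskᵗ = onesᵗ ×ᵗ halfᵗ

  topᵗ lowᵗ : Term k → Term k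
  topᵗ X = (X ∧ᵗ topMaskᵗ) ÷ᵗ halfᵗ
  lowᵗ X = X −ᵗ (X ∧ᵗ topMaskᵗ)

  andNotᵗ xorᵗ plusᵗ geqᵗ maxᵗ minᵗ : Term k → Term k → Term k
  andNotᵗ A B = A ∧ᵗ ¬ᵗ B
  xorᵗ A B = andNotᵗ A B +ᵗ andNotᵗ B A
  plusᵗ X Y = lowᵗ U +ᵗ (xorᵗ (xorᵗ (topᵗ X) (topᵗ Y)) (topᵗ U) ×ᵗ halfᵗ)
    where U = lowᵗ X +ᵗ lowᵗ Y
  geqᵗ X Y = (andNotᵗ (topᵗ X) (topᵗ Y) +ᵗ andNotᵗ (topᵗ D) (xorᵗ (topᵗ X) (topᵗ Y))) ×ᵗ maskᵗ
    where D = (lowᵗ X +ᵗ topMaskᵗ) −ᵗ lowᵗ Y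
  maxᵗ X Y = (X ∧ᵗ geqᵗ X Y) +ᵗ (Y ∧ᵗ ¬ᵗ geqᵗ X Y)
  minᵗ X Y = (Y ∧ᵗ geqᵗ X Y) +ᵗ (X ∧ᵗ ¬ᵗ geqᵗ X Y)

n<2^n : ∀ n → n < 2 ^ n
n<2^n zero = s≤s z≤n
n<2^n (suc n) = begin-strict
  suc n          ≤⟨ n<2^n n ⟩
  2 ^ n          <⟨ m<m+n (2 ^ n) (m^n>0 2 n) ⟩
  2 ^ n + 2 ^ n  ≡⟨ cong (2 ^ n +_) (+-identityʳ (2 ^ n)) ⟨
  2 ^ suc n      ∎

bit*c< : ∀ {p c n} → p ≤ 1 → c < n → p * c < n
bit*c< {p} {c} p≤1 c<n = ≤-<-trans (subst (p * c ≤_) (+-identityʳ c) (*-monoˡ-≤ c p≤1)) c<n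

module Evaluation (d t w′ N : ℕ) (2^t≡w : 2 ^ t ≡ suc w′) (n≡N*w : nOf d ≡ N * suc w′)
                  {k : ℕ} (ρ : Vec ℕ k) (z : Term k) (z≡t : evalT d ρ z ≡ t) where
  open Word d w′ N n≡N*w public
  open Gadgets z public

  ev : Term k → ℕ
  ev = evalT d ρ

  Bits : (ℕ → ℕ) → Set
  Bits f = ∀ i → i < N → f i ≤ 1

  ⟦width⟧ : ev widthᵗ ≡ w
  ⟦width⟧ = begin-equality
    interp d 𝐩 (ev z ∷ [])  ≡⟨ cong (λ v → interp d 𝐩 (v ∷ [])) z≡t ⟩
    interp d 𝐩 (t ∷ [])     ≡⟨ 𝐩≡2^ t (subst (_< M) (sym 2^t≡w) (<-≤-trans (n<2^n w) W≤M)) ⟩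
    2 ^ t                   ≡⟨ 2^t≡w ⟩
    w                       ∎

  ⟦half⟧ : ev halfᵗ ≡ h
  ⟦half⟧ = begin-equality
    interp d 𝐩 (interp d plus (ev widthᵗ ∷ M ∸ 1 ∷ []) ∷ [])
      ≡⟨ cong (λ v → interp d 𝐩 (interp d plus (v ∷ M ∸ 1 ∷ []) ∷ [])) ⟦width⟧ ⟩
    interp d 𝐩 (interp d plus (w ∷ M ∸ 1 ∷ []) ∷ [])
      ≡⟨ cong (λ v → interp d 𝐩 (v ∷ [])) (plus-[-1] w (s≤s z≤n) (<-≤-trans (n<2^n w) W≤M)) ⟩
    interp d 𝐩 (w′ ∷ [])
      ≡⟨ 𝐩≡2^ w′ (<-≤-trans h<W W≤M) ⟩
    h ∎

  ⟦mask⟧ : ev maskᵗ ≡ m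
  ⟦mask⟧ = begin-equality
    interp d plus (ev halfᵗ ∷ interp d plus (ev halfᵗ ∷ M ∸ 1 ∷ []) ∷ [])
      ≡⟨ cong (λ v → interp d plus (v ∷ interp d plus (v ∷ M ∸ 1 ∷ []) ∷ [])) ⟦half⟧ ⟩
    interp d plus (h ∷ interp d plus (h ∷ M ∸ 1 ∷ []) ∷ [])
      ≡⟨ cong (λ v → interp d plus (h ∷ v ∷ [])) (plus-[-1] h 0<h (<-≤-trans h<W W≤M)) ⟩
    (h + (h ∸ 1)) % M
      ≡⟨ cong (_% M) (trans (cong (_∸ 1) W≡h+h) (+-∸-assoc h 0<h)) ⟨
    m % M
      ≡⟨ m<n⇒m%n≡m (<-≤-trans m<W W≤M) ⟩
    m ∎

  digits-×ᵗ : ∀ X cT {c f} → ev cT ≡ c → (∀ i → i < N → f i * c < W) →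
              Digits N (ev X) f → Digits N (ev (X ×ᵗ cT)) (λ i → f i * c)
  digits-×ᵗ X cT refl = digits-times (ev cT)

  digits-÷ᵗ : ∀ X cT {c f} → ev cT ≡ c → 0 < c → (∀ i → i < N → f i < W) →
              Digits N (ev X) (λ i → f i * c) → Digits N (ev (X ÷ᵗ cT)) f
  digits-÷ᵗ X cT refl = digits-divs (ev cT)

  digits-ones : Digits N (ev onesᵗ) (λ _ → 1)
  digits-ones = digits-÷ᵗ -𝟏ᵗ maskᵗ ⟦mask⟧ 0<m (λ _ _ → 1<W)
    (digits-cong (λ _ _ → sym (*-identityˡ m)) digits-[-1])

  digits-topMask : Digits N (ev topMaskᵗ) (λ _ → h)
  digits-topMask = digits-cong (λ _ _ → *-identityˡ h)
    (digits-×ᵗ onesᵗ halfᵗ ⟦half⟧ (λ _ _ → bit*c< ≤-refl h<W) digits-ones)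

  digits-topPart : ∀ X {f} → Digits N (ev X) f → Digits N (ev (X ∧ᵗ topMaskᵗ)) (λ i → (f i / h) * h)
  digits-topPart X dX = digits-cong (λ i i<N → bitAnd-top _ (digit<B dX i i<N)) (digits-cap dX digits-topMask)

  digits-top : ∀ X {f} → Digits N (ev X) f → Digits N (ev (topᵗ X)) (λ i → f i / h)
  digits-top X dX = digits-÷ᵗ (X ∧ᵗ topMaskᵗ) halfᵗ ⟦half⟧ 0<h
    (λ i i<N → ≤-<-trans (top≤1 _ (digit<B dX i i<N)) 1<W) (digits-topPart X dX)

  digits-low : ∀ X {f} → Digits N (ev X) f → Digits N (ev (lowᵗ X)) (λ i → f i % h)
  digits-low X {f} dX = digits-cong (λ i _ → sym (m%n≡m∸m/n*n (f i) h))
    (digits-minus (λ i _ → m/n*n≤m (f i) h) dX (digits-topPart X dX))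

  top-bits : ∀ X {f} → Digits N (ev X) f → Bits (λ i → f i / h)
  top-bits X dX i i<N = top≤1 _ (digit<B dX i i<N)

  digits-andNot : ∀ A B {f g} → Bits f → Bits g → Digits N (ev A) f → Digits N (ev B) g →
                  Digits N (ev (andNotᵗ A B)) (λ i → andNot (f i) (g i))
  digits-andNot A B f≤1 g≤1 dA dB =
    digits-cong (λ i i<N → bitAnd-bitNot≡andNot _ _ (f≤1 i i<N) (g≤1 i i<N)) (digits-cap dA (digits-𝓝 dB))

  xor-bits : ∀ {f g} → Bits f → Bits g → Bits (λ i → xor (f i) (g i))
  xor-bits f≤1 g≤1 i i<N = xor≤1 (f≤1 i i<N) (g≤1 i i<N)

  digits-xor : ∀ A B {f g} → Bits f → Bits g → Digits N (ev A) f → Digits N (ev B) g →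
               Digits N (ev (xorᵗ A B)) (λ i → xor (f i) (g i))
  digits-xor A B f≤1 g≤1 dA dB =
    digits-plus (λ i i<N → ≤-<-trans (xor-bits f≤1 g≤1 i i<N) 1<W)
      (digits-andNot A B f≤1 g≤1 dA dB) (digits-andNot B A g≤1 f≤1 dB dA)

  digits-plusᵗ : ∀ X Y {f g} → Digits N (ev X) f → Digits N (ev Y) g →
                 Digits N (ev (plusᵗ X Y)) (λ i → (f i + g i) % W)
  digits-plusᵗ X Y {f} {g} dX dY =
    digits-cong (λ i i<N → +-digit (f i) (g i) (digit<B dX i i<N) (digit<B dY i i<N))
      (digits-plus (λ i i<N → lo+bit*h<W _ _ (m%n<n _ h) (carry≤1 i i<N)) (digits-low U dU) dCarry)
    where
    U = lowᵗ X +ᵗ lowᵗ Y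
    dU = digits-plus (λ i _ → lo+lo<W (f i) (g i)) (digits-low X dX) (digits-low Y dY)
    topX⊕topY≤1 = xor-bits (top-bits X dX) (top-bits Y dY)
    carry≤1 = xor-bits topX⊕topY≤1 (top-bits U dU)
    dCarry = digits-×ᵗ (xorᵗ (xorᵗ (topᵗ X) (topᵗ Y)) (topᵗ U)) halfᵗ ⟦half⟧ (λ i i<N → bit*c< (carry≤1 i i<N) h<W)
      (digits-xor (xorᵗ (topᵗ X) (topᵗ Y)) (topᵗ U) topX⊕topY≤1 (top-bits U dU)
        (digits-xor (topᵗ X) (topᵗ Y) (top-bits X dX) (top-bits Y dY) (digits-top X dX) (digits-top Y dY))
        (digits-top U dU))

  digits-geqᵗ : ∀ X Y {f g} → Digits N (ev X) f → Digits N (ev Y) g →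
                Digits N (ev (geqᵗ X Y)) (λ i → geq (f i) (g i) * m)
  digits-geqᵗ X Y {f} {g} dX dY =
    digits-×ᵗ (andNotᵗ (topᵗ X) (topᵗ Y) +ᵗ andNotᵗ (topᵗ D) (xorᵗ (topᵗ X) (topᵗ Y))) maskᵗ ⟦mask⟧
      (λ i i<N → bit*c< (geq-bits i i<N) m<W)
      (digits-plus (λ i i<N → ≤-<-trans (geq-bits i i<N) 1<W)
        (digits-andNot (topᵗ X) (topᵗ Y) (top-bits X dX) (top-bits Y dY) (digits-top X dX) (digits-top Y dY))
        (digits-andNot (topᵗ D) (xorᵗ (topᵗ X) (topᵗ Y)) (top-bits D dD) (xor-bits (top-bits X dX) (top-bits Y dY))
          (digits-top D dD)
          (digits-xor (topᵗ X) (topᵗ Y) (top-bits X dX) (top-bits Y dY) (digits-top X dX) (digits-top Y dY))))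
    where
    D = (lowᵗ X +ᵗ topMaskᵗ) −ᵗ lowᵗ Y
    dD = digits-minus (λ i _ → ≤-trans (<⇒≤ (m%n<n (g i) h)) (m≤n+m h (f i % h)))
           (digits-plus (λ i _ → subst (f i % h + h <_) (sym W≡h+h) (+-monoˡ-< h (m%n<n (f i) h))) (digits-low X dX) digits-topMask)
           (digits-low Y dY)
    geq-bits : Bits (λ i → geq (f i) (g i))
    geq-bits i i<N = geq≤1 (f i) (g i) (digit<B dX i i<N) (digit<B dY i i<N)

  digits-maxᵗ : ∀ X Y {f g} → Digits N (ev X) f → Digits N (ev Y) g → Digits N (ev (maxᵗ X Y)) (λ i → f i ⊔ g i)
  digits-maxᵗ X Y {f} {g} dX dY = digits-cong max≡ (digits-plus
    (λ i i<N → subst (_< W) (sym (max≡ i i<N)) (⊔-pres-<m (digit<B dX i i<N) (digit<B dY i i<N)))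
    (digits-cap dX dG) (digits-cap dY (digits-𝓝 dG)))
    where dG = digits-geqᵗ X Y dX dY
          max≡ : ∀ i → i < N → select (geq (f i) (g i)) (f i) (g i) ≡ f i ⊔ g i
          max≡ i i<N = max-digit (f i) (g i) (digit<B dX i i<N) (digit<B dY i i<N)

  digits-minᵗ : ∀ X Y {f g} → Digits N (ev X) f → Digits N (ev Y) g → Digits N (ev (minᵗ X Y)) (λ i → f i ⊓ g i)
  digits-minᵗ X Y {f} {g} dX dY = digits-cong min≡ (digits-plus
    (λ i i<N → subst (_< W) (sym (min≡ i i<N)) (≤-<-trans (m⊓n≤m (f i) (g i)) (digit<B dX i i<N)))
    (digits-cap dY dG) (digits-cap dX (digits-𝓝 dG)))
    where dG = digits-geqᵗ X Y dX dY
          min≡ : ∀ i → i < N → select (geq (f i) (g i)) (g i) (f i) ≡ f i ⊓ g i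
          min≡ i i<N = min-digit (f i) (g i) (digit<B dX i i<N) (digit<B dY i i<N)

  digits-widths : Digits N (ev widthsᵗ) (λ _ → w)
  digits-widths = digits-cong (λ _ _ → *-identityˡ w)
    (digits-×ᵗ onesᵗ widthᵗ ⟦width⟧ (λ _ _ → bit*c< ≤-refl (n<2^n w)) digits-ones)

formula : ∀ {k} (f : Sym k) → ¬ Forbidden f → ExFormula (k + 2)
formula 𝟎 _ = qf (var (# 0) ≐ app 𝟎 [])
formula 𝟏 _ = qf (var (# 0) ≐ Gadgets.onesᵗ (var (# 1)))
formula -𝟏 _ = qf (var (# 0) ≐ -𝟏ᵗ)
formula 𝐧 _ = qf (var (# 0) ≐ Gadgets.widthsᵗ (var (# 1)))
formula 𝓝 _ = qf (var (# 1) ≐ (¬ᵗ var (# 0)))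
formula 𝐩 ¬forbidden = ⊥-elim (¬forbidden isP)
formula plus _ = qf (var (# 2) ≐ Gadgets.plusᵗ (var (# 3)) (var (# 0)) (var (# 1)))
formula times ¬forbidden = ⊥-elim (¬forbidden isTimes)
formula divs ¬forbidden = ⊥-elim (¬forbidden isDiv)
formula mx _ = qf (var (# 2) ≐ Gadgets.maxᵗ (var (# 3)) (var (# 0)) (var (# 1)))
formula mn _ = qf (var (# 2) ≐ Gadgets.minᵗ (var (# 3)) (var (# 0)) (var (# 1)))
formula cap _ = qf (var (# 2) ≐ (var (# 0) ∧ᵗ var (# 1)))

module Componentwise (d t : ℕ) (t≤d : t ≤ d) where
  w′ = 2 ^ t ∸ 1
  N = 2 ^ (d ∸ t)

  2^t≡w : 2 ^ t ≡ suc w′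
  2^t≡w = sym (suc-pred (2 ^ t) {{2^≢0 t}})

  n≡N*w : nOf d ≡ N * suc w′
  n≡N*w = begin-equality
    2 ^ d                ≡⟨ cong (2 ^_) (m∸n+n≡m t≤d) ⟨
    2 ^ (d ∸ t + t)      ≡⟨ ^-distribˡ-+-* 2 (d ∸ t) t ⟩
    N * 2 ^ t            ≡⟨ cong (N *_) 2^t≡w ⟩
    N * suc w′           ∎

  open Word d w′ N n≡N*w

  module Eval₀ (b : ℕ) = Evaluation d t w′ N 2^t≡w n≡N*w (b ∷ t ∷ []) (var (# 1)) refl
  module Eval₂ (x y b : ℕ) = Evaluation d t w′ N 2^t≡w n≡N*w (x ∷ y ∷ b ∷ t ∷ []) (var (# 3)) refl

  digit≡digitOf : ∀ a i → digit a i t ≡ digitOf a i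
  digit≡digitOf a i = begin-equality
    modPow2 (divPow2 a (i * 2 ^ t)) (2 ^ t)  ≡⟨ cong (λ v → modPow2 (divPow2 a (i * v)) v) 2^t≡w ⟩
    modPow2 (divPow2 a (i * w)) w            ≡⟨ cong (_% W) (/-congʳ {{2^≢0 (i * w)}} {{m^n≢0 W i}} 2^iw≡W^i) ⟩
    digitOf a i                              ∎
    where 2^iw≡W^i : 2 ^ (i * w) ≡ W ^ i
          2^iw≡W^i = trans (cong (2 ^_) (*-comm i w)) (sym (^-*-assoc 2 w i))

  digits-own : ∀ {a} → a < M → Digits N a (digitOf a)
  digits-own {a} a<M = digits-digitOf N a (subst (a <_) M≡W^N a<M)

  -- Since b is determined by its digits, "f_{d,t}(as) = b" is the equation b = val for any
  -- val whose digits are the componentwise values.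
  digitwise⇔≡ : ∀ {val G} (T : ℕ → ℕ) b → Digits N val G → (∀ i → i < N → T i ≡ G i) → b < M →
                (b < M × (∀ i → i < N → T i ≡ digit b i t)) ⇔ (b ≡ val)
  digitwise⇔≡ {val} {G} T b dVal T≗G b<M = mk⇔
    (λ (_ , T≗b) → digits-injective
      (digits-cong (λ i i<N → trans (sym (digit≡digitOf b i)) (trans (sym (T≗b i i<N)) (T≗G i i<N))) (digits-own b<M))
      dVal)
    (λ { refl → b<M , λ i i<N → trans (T≗G i i<N) (sym (trans (digit≡digitOf b i) (digitOf-digits dVal i i<N))) })

  correct : ∀ {k} (f : Sym k) (¬forbidden : ¬ Forbidden f) (as : Vec ℕ k) → All (_< M) as →
            ∀ b → b < M → CompValue d t f as b ⇔ Sat d (as ++ (b ∷ t ∷ [])) (formula f ¬forbidden)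
  correct 𝟎 _ [] [] b b<M = digitwise⇔≡ _ b (digits-zero N) (λ _ _ → refl) b<M
  correct 𝟏 _ [] [] b b<M = digitwise⇔≡ _ b (Eval₀.digits-ones b) (λ _ _ → refl) b<M
  correct -𝟏 _ [] [] b b<M = digitwise⇔≡ _ b digits-[-1] (λ _ _ → cong (λ v → 2 ^ v ∸ 1) 2^t≡w) b<M
  correct 𝐧 _ [] [] b b<M = digitwise⇔≡ _ b (Eval₀.digits-widths b) (λ _ _ → 2^t≡w) b<M
  correct 𝓝 _ (x ∷ []) (x<M ∷ []) b b<M = digitwise⇔≡ _ b (digits-𝓝 (digits-own x<M))
    (λ i _ → cong₂ bitNot 2^t≡w (digit≡digitOf x i)) b<M
  correct 𝐩 ¬forbidden = ⊥-elim (¬forbidden isP)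
  correct plus _ (x ∷ y ∷ []) (x<M ∷ y<M ∷ []) b b<M = digitwise⇔≡ _ b
    (Eval₂.digits-plusᵗ x y b (var (# 0)) (var (# 1)) (digits-own x<M) (digits-own y<M))
    (λ i _ → cong₂ (λ v u → modPow2 u v) 2^t≡w (cong₂ _+_ (digit≡digitOf x i) (digit≡digitOf y i))) b<M
  correct times ¬forbidden = ⊥-elim (¬forbidden isTimes)
  correct divs ¬forbidden = ⊥-elim (¬forbidden isDiv)
  correct mx _ (x ∷ y ∷ []) (x<M ∷ y<M ∷ []) b b<M = digitwise⇔≡ _ b
    (Eval₂.digits-maxᵗ x y b (var (# 0)) (var (# 1)) (digits-own x<M) (digits-own y<M))
    (λ i _ → cong₂ _⊔_ (digit≡digitOf x i) (digit≡digitOf y i)) b<M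
  correct mn _ (x ∷ y ∷ []) (x<M ∷ y<M ∷ []) b b<M = digitwise⇔≡ _ b
    (Eval₂.digits-minᵗ x y b (var (# 0)) (var (# 1)) (digits-own x<M) (digits-own y<M))
    (λ i _ → cong₂ _⊓_ (digit≡digitOf x i) (digit≡digitOf y i)) b<M
  correct cap _ (x ∷ y ∷ []) (x<M ∷ y<M ∷ []) b b<M = digitwise⇔≡ _ b
    (digits-cap (digits-own x<M) (digits-own y<M))
    (λ i _ → trans (cong (λ v → bitAnd v (digit x i t) (digit y i t)) 2^t≡w)
                   (cong₂ (bitAnd w) (digit≡digitOf x i) (digit≡digitOf y i))) b<M

theorem6 : ∀ {k} (f : Sym k) → k ≤ 2 → ¬ Forbidden f →
    Σ (ExFormula (k + 2)) λ ψ →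
      ∀ d t → t ≤ d →
      (as : Vec ℕ k) → All (_< size d) as →
      (b : ℕ) → b < size d →
      (CompValue d t f as b ⇔ Sat d (as ++ (b ∷ t ∷ [])) ψ)
theorem6 f _ ¬forbidden = formula f ¬forbidden , λ d t t≤d → Componentwise.correct d t t≤d f ¬forbidden
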